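{- For every odd integer $k\geq3$, $\operatorname{rank}M_k=k-2$.
   Context: For integers $j$, let $\delta_{j,\mathrm{ev}}=1$ if $j$ is even and $0$ otherwise, $\delta_{j,\mathrm{od}}=1-\delta_{j,\mathrm{ev}}$, and $\delta_{j,k-r}$ the Kronecker delta. For odd $k$, $M_k$ is the $(k-2)\times(k-1)$ rational matrix with rows indexed by $1\le j\le k-2$, columns by $1\le r\le k-1$, and entries $$(-1)^r(1-\delta_{j,k-r})\delta_{j,\mathrm{ev}}\binom{k-j-1}{r-1}+(-1)^r\delta_{j,\mathrm{od}}\binom{k-j-1}{k-r-1}.$$ -}

module Defs where

open import Data.Nat using (ℕ; zero; suc; _+_; _∸_; _%_; _≡ᵇ_)
open import Data.Nat.Combinatorics using (_C_)
open import Data.Bool using (Bool; true; false; if_then_else_; not)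
open import Data.Fin using (Fin; toℕ) renaming (zero to Fz; suc to Fs)
open import Data.Product using (Σ; _×_)
open import Data.Rational using (ℚ; 0ℚ; 1ℚ; -_; _*_) renaming (_+_ to _+ℚ_)
open import Data.Rational as Q using ()
open import Data.Integer using (+_)
open import Relation.Binary.PropositionalEquality using (_≡_)
open import Relation.Nullary using (¬_)
open import Function.Definitions using (Injective)

Matrix : ℕ → ℕ → Set
Matrix m n = Fin m → Fin n → ℚ

Σℚ : (s : ℕ) → (Fin s → ℚ) → ℚ
Σℚ zero    f = 0ℚ
Σℚ (suc s) f = f Fz +ℚ Σℚ s (λ i → f (Fs i))


LinIndep : {s n : ℕ} → (Fin s → Fin n → ℚ) → Set
LinIndep {s} {n} v =
  (c : Fin s → ℚ) → ((col : Fin n) → Σℚ s (λ i → c i * v i col) ≡ 0ℚ) →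
  (i : Fin s) → c i ≡ 0ℚ

IsRank : {m n : ℕ} → Matrix m n → ℕ → Set
IsRank {m} {n} M r =
  Σ (Fin r → Fin m) (λ f → Injective _≡_ _≡_ f × LinIndep (λ i → M (f i)))
  × ((f : Fin (suc r) → Fin m) → Injective _≡_ _≡_ f → ¬ LinIndep (λ i → M (f i)))

isEven : ℕ → Bool
isEven j = (j % 2) ≡ᵇ 0

sign : ℕ → ℚ
sign r = if isEven r then 1ℚ else - 1ℚ

-- the entry of M_k at (j , r), 1-indexed, as in the paper
entry : (k j r : ℕ) → ℚ
entry k j r =
  sign r * ((+ (term1 + term2)) Q./ 1)
  where
  term1 : ℕ
  term1 = if isEven j then (if j ≡ᵇ (k ∸ r) then 0 else ((k ∸ j ∸ 1) C (r ∸ 1))) else 0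
  term2 : ℕ
  term2 = if isEven j then 0 else ((k ∸ j ∸ 1) C (k ∸ r ∸ 1))

M : (k : ℕ) → Matrix (k ∸ 2) (k ∸ 1)
M k i c = entry k (suc (toℕ i)) (suc (toℕ c))

-- Number the rows of M_k by t = j - 1 < N = k - 2 and read row j as the polynomial
-- Σ_r (-1)^r M_k[j][r] x^(r-1).  By the binomial theorem it is x^t (1+x)^(N-t) for even t and
-- (1+x)^(N-t) - x^(N-t) for odd t: the restriction to the line Y = X + 1 of the binary form of
-- degree N given by X^t Y^(N-t), resp. (Y-X)^t (Y^(N-t) - X^(N-t)).  A combination F of these
-- forms that vanishes on the line is, by homogeneity, zero wherever X ≠ Y.  The forms with odd t
-- are symmetric in X and Y, so, N being odd, F(y,1) - F(1,y) + F(-y,1) - F(1,-y) is the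
-- polynomial Σ_{t even} 2 c_t y^t; it vanishes at every natural y ≥ 2, hence c_t = 0 for even t.
-- What remains of the combination is G(1+x) - G(x) for G(y) = Σ_t c_t y^(N-t); as G(0) = 0, G
-- vanishes at every natural number, so all c_t = 0.  Finally N + 1 distinct rows cannot be
-- chosen among N, so the rank is exactly N.

module Submission where

open import Defs

open import Algebra.Bundles using (CommutativeRing)
open import Level using (0ℓ)
open import Data.Bool using (Bool; true; false; not; T; if_then_else_)
open import Data.Bool.Properties using (¬-not; T-≡)
open import Data.Fin using (Fin; toℕ; opposite) renaming (zero to Fz; suc to Fs)
open import Data.Fin.Properties using (toℕ<n; opposite-prop; opposite-involutive; <⇒notInjective)
import Data.Fin.Permutation as Perm
import Data.Integer as ℤ
import Data.Integer.Properties as ℤ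
open import Data.Nat as ℕ using (ℕ; zero; suc; z≤n; s≤s; _≤_; _%_; _∸_) renaming (_+_ to _+ℕ_)
open import Data.Nat.Combinatorics using (_C_; k>n⇒nCk≡0; nCk≡nC[n∸k]; nCn≡1)
import Data.Nat.Properties as ℕ
open import Data.Product using (_,_)
open import Data.Rational as ℚ using (ℚ; 0ℚ; 1ℚ; -_; _*_; _+_; _-_; _/_; 1/_)
import Data.Rational.Properties as ℚ
open import Data.Rational.Literals using (fromℤ)
open import Function using (_∘_; id)
open import Function.Bundles using (Equivalence)
open import Relation.Binary.PropositionalEquality
  using (_≡_; _≢_; refl; sym; trans; cong; cong₂; subst; module ≡-Reasoning)
open import Relation.Nullary.Decidable using (dec⇒maybe)
open import Tactic.RingSolver using (solve-∀)
open import Tactic.RingSolver.Core.AlmostCommutativeRing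
  using (AlmostCommutativeRing; fromCommutativeRing)

open CommutativeRing ℚ.+-*-commutativeRing using (semiring; commutativeSemiring; *-commutativeSemigroup)
open import Algebra.Properties.CommutativeSemigroup *-commutativeSemigroup using (x∙yz≈y∙xz; interchange)
open import Algebra.Properties.Semiring.Exp semiring using (_^_; ^-homo-*)
open import Algebra.Properties.CommutativeSemiring.Exp commutativeSemiring using (^-distrib-*)
open import Algebra.Properties.Semiring.Mult semiring using (_×_)
open import Algebra.Properties.Semiring.Sum semiring
  using (sum; ∑-comm; ∑-distrib-+; ∑-permute; *-distribˡ-sum; *-distribʳ-sum; sum-cong-≗; sum-replicate-zero)
import Algebra.Properties.CommutativeSemiring.Binomial commutativeSemiring as Binomial
open import Algebra.Properties.Group ℚ.+-0-group using (x∙y⁻¹≈ε⇒x≈y)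

ℚ-ring : AlmostCommutativeRing 0ℓ 0ℓ
ℚ-ring = fromCommutativeRing ℚ.+-*-commutativeRing (λ x → dec⇒maybe (0ℚ ℚ.≟ x))

fromℕ : ℕ → ℚ
fromℕ n = ℤ.+ n / 1

fromℕ≡fromℤ : ∀ n → fromℕ n ≡ fromℤ (ℤ.+ n)
fromℕ≡fromℤ n = ℚ.↥p/↧p≡p (fromℤ (ℤ.+ n))

fromℕ-+ : ∀ m n → fromℕ (m +ℕ n) ≡ fromℕ m + fromℕ n
fromℕ-+ m n = sym (begin
  fromℕ m + fromℕ n                          ≡⟨ cong₂ _+_ (fromℕ≡fromℤ m) (fromℕ≡fromℤ n) ⟩
  fromℤ (ℤ.+ m) + fromℤ (ℤ.+ n)              ≡⟨⟩
  (ℤ.+ m ℤ.* ℤ.+ 1 ℤ.+ ℤ.+ n ℤ.* ℤ.+ 1) / 1  ≡⟨ cong (λ z → z / 1) (cong₂ ℤ._+_ (ℤ.*-identityʳ (ℤ.+ m)) (ℤ.*-identityʳ (ℤ.+ n))) ⟩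
  fromℕ (m +ℕ n)                             ∎)
  where open ≡-Reasoning

fromℕ-injective : ∀ {m n} → fromℕ m ≡ fromℕ n → m ≡ n
fromℕ-injective {m} {n} eq =
  ℤ.+-injective (cong ℚ.↥_ (trans (sym (fromℕ≡fromℤ m)) (trans eq (fromℕ≡fromℤ n))))

fromℕ≢-1 : ∀ n → fromℕ n ≢ - 1ℚ
fromℕ≢-1 n eq with cong ℚ.↥_ (trans (sym (fromℕ≡fromℤ n)) eq)
... | ()

×≡fromℕ* : ∀ n x → n × x ≡ fromℕ n * x
×≡fromℕ* zero    x = sym (ℚ.*-zeroˡ x)
×≡fromℕ* (suc n) x = begin
  x + n × x                ≡⟨ cong (x +_) (×≡fromℕ* n x) ⟩
  x + fromℕ n * x          ≡⟨ cong (_+ fromℕ n * x) (ℚ.*-identityˡ x) ⟨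
  1ℚ * x + fromℕ n * x     ≡⟨ ℚ.*-distribʳ-+ x 1ℚ (fromℕ n) ⟨
  (1ℚ + fromℕ n) * x       ≡⟨ cong (_* x) (sym (fromℕ-+ 1 n)) ⟩
  fromℕ (suc n) * x        ∎
  where open ≡-Reasoning

x*y≡0⇒y≡0 : ∀ {x y} → x ≢ 0ℚ → x * y ≡ 0ℚ → y ≡ 0ℚ
x*y≡0⇒y≡0 {x} {y} x≢0 xy≡0 = begin
  y                  ≡⟨ sym (ℚ.*-identityˡ y) ⟩
  1ℚ * y             ≡⟨ cong (_* y) (sym (ℚ.*-inverseˡ x)) ⟩
  (1/ x * x) * y     ≡⟨ ℚ.*-assoc (1/ x) x y ⟩
  1/ x * (x * y)     ≡⟨ cong (1/ x *_) xy≡0 ⟩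
  1/ x * 0ℚ          ≡⟨ ℚ.*-zeroʳ (1/ x) ⟩
  0ℚ                 ∎
  where
  open ≡-Reasoning
  instance
    x-nonZero : ℚ.NonZero x
    x-nonZero = ℚ.≢-nonZero x≢0

x+x≡0⇒x≡0 : ∀ {x} → x + x ≡ 0ℚ → x ≡ 0ℚ
x+x≡0⇒x≡0 {x} x+x≡0 = x*y≡0⇒y≡0 {1ℚ + 1ℚ} (λ ()) (trans (lemma x) x+x≡0)
  where
  lemma : ∀ x → (1ℚ + 1ℚ) * x ≡ x + x
  lemma = solve-∀ ℚ-ring

isEven-suc : ∀ n → isEven (suc n) ≡ not (isEven n)
isEven-suc zero          = refl
isEven-suc (suc zero)    = refl
isEven-suc (suc (suc n)) = isEven-suc n

isEven-∸ : ∀ {N t} → isEven N ≡ false → isEven t ≡ true → t ≤ N → isEven (N ∸ t) ≡ false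
isEven-∸ {N} {zero}        N-odd _      _               = N-odd
isEven-∸ {N} {suc zero}    _     ()     _
isEven-∸ {suc (suc N)} {suc (suc t)} N-odd t-even (s≤s (s≤s t≤N)) = isEven-∸ {N} {t} N-odd t-even t≤N

1^n≡1 : ∀ n → 1ℚ ^ n ≡ 1ℚ
1^n≡1 zero    = refl
1^n≡1 (suc n) = trans (ℚ.*-identityˡ (1ℚ ^ n)) (1^n≡1 n)

0^[1+n]≡0 : ∀ n → 0ℚ ^ suc n ≡ 0ℚ
0^[1+n]≡0 n = ℚ.*-zeroˡ (0ℚ ^ n)

-x^even : ∀ x {n} → isEven n ≡ true → (- x) ^ n ≡ x ^ n
-x^odd  : ∀ x {n} → isEven n ≡ false → (- x) ^ n ≡ - (x ^ n)
-x^even x {zero}        _ = refl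
-x^even x {suc (suc n)} e = begin
  - x * (- x * (- x) ^ n)  ≡⟨ cong (λ p → - x * (- x * p)) (-x^even x {n} e) ⟩
  - x * (- x * x ^ n)      ≡⟨ lemma x (x ^ n) ⟩
  x * (x * x ^ n)          ∎
  where
  open ≡-Reasoning
  lemma : ∀ x p → - x * (- x * p) ≡ x * (x * p)
  lemma = solve-∀ ℚ-ring
-x^odd x {suc zero}    _ = sym (ℚ.neg-distribˡ-* x 1ℚ)
-x^odd x {suc (suc n)} e = begin
  - x * (- x * (- x) ^ n)  ≡⟨ cong (λ p → - x * (- x * p)) (-x^odd x {n} e) ⟩
  - x * (- x * - (x ^ n))  ≡⟨ lemma x (x ^ n) ⟩
  - (x * (x * x ^ n))      ∎
  where
  open ≡-Reasoning
  lemma : ∀ x p → - x * (- x * - p) ≡ - (x * (x * p))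
  lemma = solve-∀ ℚ-ring

Σℚ≡sum : ∀ s (f : Fin s → ℚ) → Σℚ s f ≡ sum f
Σℚ≡sum zero    f = refl
Σℚ≡sum (suc s) f = cong (f Fz +_) (Σℚ≡sum s (f ∘ Fs))

∑-distrib-- : ∀ {n} (f g : Fin n → ℚ) → sum (λ i → f i - g i) ≡ sum f - sum g
∑-distrib-- {zero}  f g = refl
∑-distrib-- {suc n} f g = begin
  f Fz - g Fz + sum (λ i → f (Fs i) - g (Fs i))       ≡⟨ cong (f Fz - g Fz +_) (∑-distrib-- (f ∘ Fs) (g ∘ Fs)) ⟩
  f Fz - g Fz + (sum (f ∘ Fs) - sum (g ∘ Fs))         ≡⟨ lemma (f Fz) (g Fz) (sum (f ∘ Fs)) (sum (g ∘ Fs)) ⟩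
  f Fz + sum (f ∘ Fs) - (g Fz + sum (g ∘ Fs))         ∎
  where
  open ≡-Reasoning
  lemma : ∀ a b s t → a - b + (s - t) ≡ a + s - (b + t)
  lemma = solve-∀ ℚ-ring

∑< : ℕ → (ℕ → ℚ) → ℚ
∑< n f = sum {n} (f ∘ toℕ)

∑<-cong : ∀ n {f g : ℕ → ℚ} → (∀ {u} → u ℕ.< n → f u ≡ g u) → ∑< n f ≡ ∑< n g
∑<-cong n f≗g = sum-cong-≗ (λ i → f≗g (toℕ<n i))

∑<-zero : ∀ n {f : ℕ → ℚ} → (∀ {u} → u ℕ.< n → f u ≡ 0ℚ) → ∑< n f ≡ 0ℚ
∑<-zero zero    f≡0 = refl
∑<-zero (suc n) {f} f≡0 = begin
  f 0 + ∑< n (f ∘ suc)  ≡⟨ cong₂ _+_ (f≡0 (s≤s z≤n)) (∑<-zero n (f≡0 ∘ s≤s)) ⟩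
  0ℚ + 0ℚ               ≡⟨⟩
  0ℚ                    ∎
  where open ≡-Reasoning

∑<-+ : ∀ m n (f : ℕ → ℚ) → ∑< (m +ℕ n) f ≡ ∑< m f + ∑< n (λ u → f (m +ℕ u))
∑<-+ zero    n f = sym (ℚ.+-identityˡ (∑< n f))
∑<-+ (suc m) n f = begin
  f 0 + ∑< (m +ℕ n) (f ∘ suc)                                   ≡⟨ cong (f 0 +_) (∑<-+ m n (f ∘ suc)) ⟩
  f 0 + (∑< m (f ∘ suc) + ∑< n (λ u → f (suc m +ℕ u)))          ≡⟨ ℚ.+-assoc (f 0) _ _ ⟨
  f 0 + ∑< m (f ∘ suc) + ∑< n (λ u → f (suc m +ℕ u))            ∎
  where open ≡-Reasoning

∑<-suc : ∀ n (f : ℕ → ℚ) → ∑< (suc n) f ≡ ∑< n f + f n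
∑<-suc zero    f = trans (ℚ.+-identityʳ (f 0)) (sym (ℚ.+-identityˡ (f 0)))
∑<-suc (suc n) f = begin
  f 0 + ∑< (suc n) (f ∘ suc)          ≡⟨ cong (f 0 +_) (∑<-suc n (f ∘ suc)) ⟩
  f 0 + (∑< n (f ∘ suc) + f (suc n))  ≡⟨ ℚ.+-assoc (f 0) _ _ ⟨
  f 0 + ∑< n (f ∘ suc) + f (suc n)    ∎
  where open ≡-Reasoning

∑<-binomial : ∀ n x → ∑< (suc n) (λ u → fromℕ (n C u) * x ^ u) ≡ (1ℚ + x) ^ n
∑<-binomial n x = begin
  ∑< (suc n) (λ u → fromℕ (n C u) * x ^ u)   ≡⟨ sum-cong-≗ {suc n} term ⟩
  Binomial.binomialExpansion x 1ℚ n          ≡⟨ Binomial.theorem n x 1ℚ ⟨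
  (x + 1ℚ) ^ n                               ≡⟨ cong (_^ n) (ℚ.+-comm x 1ℚ) ⟩
  (1ℚ + x) ^ n                               ∎
  where
  open ≡-Reasoning
  term : ∀ k → fromℕ (n C toℕ k) * x ^ toℕ k ≡ (n C toℕ k) × (x ^ toℕ k * 1ℚ ^ (n ∸ toℕ k))
  term k = begin
    fromℕ (n C toℕ k) * x ^ toℕ k                          ≡⟨ cong (λ p → fromℕ (n C toℕ k) * p) (ℚ.*-identityʳ (x ^ toℕ k)) ⟨
    fromℕ (n C toℕ k) * (x ^ toℕ k * 1ℚ)                   ≡⟨ cong (λ p → fromℕ (n C toℕ k) * (x ^ toℕ k * p)) (1^n≡1 (n ∸ toℕ k)) ⟨
    fromℕ (n C toℕ k) * (x ^ toℕ k * 1ℚ ^ (n ∸ toℕ k))     ≡⟨ ×≡fromℕ* (n C toℕ k) _ ⟨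
    (n C toℕ k) × (x ^ toℕ k * 1ℚ ^ (n ∸ toℕ k))           ∎

-- Polynomials vanishing at all large natural numbers

polynomial : ∀ {d} → (Fin d → ℚ) → ℚ → ℚ
polynomial b y = sum (λ i → b i * y ^ toℕ i)

polynomial-horner : ∀ {d} (b : Fin (suc d) → ℚ) y → polynomial b y ≡ b Fz + y * polynomial (b ∘ Fs) y
polynomial-horner {d} b y = cong₂ _+_ (ℚ.*-identityʳ (b Fz)) (begin
  sum {d} (λ i → b (Fs i) * (y * y ^ toℕ i))   ≡⟨ sum-cong-≗ {d} (λ i → x∙yz≈y∙xz (b (Fs i)) y (y ^ toℕ i)) ⟩
  sum {d} (λ i → y * (b (Fs i) * y ^ toℕ i))   ≡⟨ *-distribˡ-sum {d} y (λ i → b (Fs i) * y ^ toℕ i) ⟨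
  y * polynomial (b ∘ Fs) y                    ∎)
  where open ≡-Reasoning

polynomial-zero : ∀ {d} {b : Fin d → ℚ} → (∀ i → b i ≡ 0ℚ) → ∀ y → polynomial b y ≡ 0ℚ
polynomial-zero {d} {b} b≡0 y =
  trans (sum-cong-≗ {d} (λ i → trans (cong (_* y ^ toℕ i) (b≡0 i)) (ℚ.*-zeroˡ (y ^ toℕ i)))) (sum-replicate-zero d)

quotient : ∀ {d} → ℚ → (Fin (suc d) → ℚ) → Fin d → ℚ
quotient {suc d} a b Fz     = polynomial (b ∘ Fs) a
quotient {suc d} a b (Fs i) = quotient a (b ∘ Fs) i

polynomial-factor : ∀ {d} a (b : Fin (suc d) → ℚ) y →
                    polynomial b y ≡ (y - a) * polynomial (quotient a b) y + polynomial b a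
polynomial-factor {zero} a b y = begin
  polynomial b y                  ≡⟨ polynomial-horner b y ⟩
  b Fz + y * 0ℚ                   ≡⟨ lemma (b Fz) y a ⟩
  (y - a) * 0ℚ + (b Fz + a * 0ℚ)  ≡⟨ cong ((y - a) * 0ℚ +_) (polynomial-horner b a) ⟨
  (y - a) * 0ℚ + polynomial b a   ∎
  where
  open ≡-Reasoning
  lemma : ∀ b y a → b + y * 0ℚ ≡ (y - a) * 0ℚ + (b + a * 0ℚ)
  lemma = solve-∀ ℚ-ring
polynomial-factor {suc d} a b y = begin
  polynomial b y                              ≡⟨ polynomial-horner b y ⟩
  b Fz + y * P y                              ≡⟨ cong (λ p → b Fz + y * p) (polynomial-factor a (b ∘ Fs) y) ⟩
  b Fz + y * ((y - a) * Q + P a)              ≡⟨ lemma (b Fz) y a Q (P a) ⟩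
  (y - a) * (P a + y * Q) + (b Fz + a * P a)  ≡⟨ cong₂ (λ p r → (y - a) * p + r) (polynomial-horner (quotient a b) y) (polynomial-horner b a) ⟨
  (y - a) * polynomial (quotient a b) y + polynomial b a ∎
  where
  open ≡-Reasoning
  P : ℚ → ℚ
  P = polynomial (b ∘ Fs)
  Q : ℚ
  Q = polynomial (quotient a (b ∘ Fs)) y
  lemma : ∀ b y a q p → b + y * ((y - a) * q + p) ≡ (y - a) * (p + y * q) + (b + a * p)
  lemma = solve-∀ ℚ-ring

fromℕ-difference≢0 : ∀ {m n} → m ≢ n → fromℕ m - fromℕ n ≢ 0ℚ
fromℕ-difference≢0 {m} {n} m≢n eq = m≢n (fromℕ-injective (x∙y⁻¹≈ε⇒x≈y (fromℕ m) (fromℕ n) eq))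

quotient-vanishes : ∀ {d} (b : Fin (suc d) → ℚ) {K n} → K ℕ.< n →
                    polynomial b (fromℕ K) ≡ 0ℚ → polynomial b (fromℕ n) ≡ 0ℚ →
                    polynomial (quotient (fromℕ K) b) (fromℕ n) ≡ 0ℚ
quotient-vanishes b {K} {n} K<n b[K]≡0 b[n]≡0 = x*y≡0⇒y≡0 (fromℕ-difference≢0 (ℕ.>⇒≢ K<n)) (begin
  (y - a) * q                      ≡⟨ lemma ((y - a) * q) (polynomial b a) ⟩
  (y - a) * q + polynomial b a - polynomial b a  ≡⟨ cong (_- polynomial b a) (polynomial-factor a b y) ⟨
  polynomial b y - polynomial b a  ≡⟨ cong₂ _-_ b[n]≡0 b[K]≡0 ⟩
  0ℚ                               ∎)
  where
  open ≡-Reasoning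
  a y q : ℚ
  a = fromℕ K
  y = fromℕ n
  q = polynomial (quotient a b) y
  lemma : ∀ x r → x ≡ x + r - r
  lemma = solve-∀ ℚ-ring

-- By induction the quotient by y - K is zero, so the polynomial is identically zero; evaluating
-- at 0 and dividing by y then disposes of every coefficient.
polynomial-vanishing : ∀ {d} (b : Fin d → ℚ) K →
                       (∀ n → K ≤ n → polynomial b (fromℕ n) ≡ 0ℚ) → ∀ i → b i ≡ 0ℚ
polynomial-vanishing {zero}  b K vanishes ()
polynomial-vanishing {suc d} b K vanishes = λ { Fz → head≡0 ; (Fs i) → tail≡0 i }
  where
  open ≡-Reasoning
  a : ℚ
  a = fromℕ K
  p : ℚ → ℚ
  p = polynomial b
  quotient≡0 : ∀ i → quotient a b i ≡ 0ℚ
  quotient≡0 = polynomial-vanishing (quotient a b) (suc K) λ n K<n →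
    quotient-vanishes b K<n (vanishes K ℕ.≤-refl) (vanishes n (ℕ.<⇒≤ K<n))
  p≡0 : ∀ y → p y ≡ 0ℚ
  p≡0 y = begin
    p y                                           ≡⟨ polynomial-factor a b y ⟩
    (y - a) * polynomial (quotient a b) y + p a   ≡⟨ cong₂ (λ q r → (y - a) * q + r) (polynomial-zero quotient≡0 y) (vanishes K ℕ.≤-refl) ⟩
    (y - a) * 0ℚ + 0ℚ                             ≡⟨ lemma (y - a) ⟩
    0ℚ                                            ∎
    where
    lemma : ∀ x → x * 0ℚ + 0ℚ ≡ 0ℚ
    lemma = solve-∀ ℚ-ring
  head≡0 : b Fz ≡ 0ℚ
  head≡0 = begin
    b Fz                                 ≡⟨ ℚ.+-identityʳ (b Fz) ⟨
    b Fz + 0ℚ                            ≡⟨ cong (b Fz +_) (ℚ.*-zeroˡ (polynomial (b ∘ Fs) 0ℚ)) ⟨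
    b Fz + 0ℚ * polynomial (b ∘ Fs) 0ℚ   ≡⟨ polynomial-horner b 0ℚ ⟨
    p 0ℚ                                 ≡⟨ p≡0 0ℚ ⟩
    0ℚ                                   ∎
  tail-vanishes : ∀ n → 1 ≤ n → polynomial (b ∘ Fs) (fromℕ n) ≡ 0ℚ
  tail-vanishes (suc n) _ = x*y≡0⇒y≡0 {y} (λ eq → ℕ.1+n≢0 (fromℕ-injective {suc n} {0} eq)) (begin
    y * polynomial (b ∘ Fs) y          ≡⟨ ℚ.+-identityˡ (y * polynomial (b ∘ Fs) y) ⟨
    0ℚ + y * polynomial (b ∘ Fs) y     ≡⟨ cong (_+ y * polynomial (b ∘ Fs) y) head≡0 ⟨
    b Fz + y * polynomial (b ∘ Fs) y   ≡⟨ polynomial-horner b y ⟨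
    p y                                ≡⟨ p≡0 y ⟩
    0ℚ                                 ∎)
    where
    y : ℚ
    y = fromℕ (suc n)
  tail≡0 : ∀ i → b (Fs i) ≡ 0ℚ
  tail≡0 = polynomial-vanishing (b ∘ Fs) 1 tail-vanishes

-- The rows of M as polynomials

sign² : ∀ r → sign r * sign r ≡ 1ℚ
sign² r with isEven r
... | true  = refl
... | false = refl

sign*sign* : ∀ r x → sign r * (sign r * x) ≡ x
sign*sign* r x = trans (sym (ℚ.*-assoc (sign r) (sign r) x)) (trans (cong (_* x) (sign² r)) (ℚ.*-identityˡ x))

[1+m∸n]∸1≡m∸n : ∀ {m n} → n ≤ m → suc m ∸ n ∸ 1 ≡ m ∸ n
[1+m∸n]∸1≡m∸n n≤m = cong (_∸ 1) (ℕ.+-∸-assoc 1 n≤m)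

≢⇒≡ᵇ≡false : ∀ {m n} → m ≢ n → (m ℕ.≡ᵇ n) ≡ false
≢⇒≡ᵇ≡false {m} {n} m≢n = ¬-not (λ eq → m≢n (ℕ.≡ᵇ⇒≡ m n (subst T (sym eq) _)))

entry-byParity : ∀ k j r b → isEven j ≡ b →
  entry k j r ≡ sign r * fromℕ ((if b then (if j ℕ.≡ᵇ k ∸ r then 0 else (k ∸ j ∸ 1) C (r ∸ 1)) else 0)
                                 +ℕ (if b then 0 else (k ∸ j ∸ 1) C (k ∸ r ∸ 1)))
entry-byParity k j r b refl = refl

entry*sign : ∀ k j r m p → entry k j r ≡ sign r * fromℕ m → entry k j r * (sign r * p) ≡ fromℕ m * p
entry*sign k j r m p eq = begin
  entry k j r * (sign r * p)           ≡⟨ cong (λ e → e * (sign r * p)) eq ⟩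
  sign r * fromℕ m * (sign r * p)      ≡⟨ lemma (sign r) (fromℕ m) p ⟩
  sign r * (sign r * (fromℕ m * p))    ≡⟨ sign*sign* r (fromℕ m * p) ⟩
  fromℕ m * p                          ∎
  where
  open ≡-Reasoning
  lemma : ∀ s c p → s * c * (s * p) ≡ s * (s * (c * p))
  lemma = solve-∀ ℚ-ring

signedEntry-oddIndex : ∀ k j r p → isEven j ≡ false →
                       entry k j r * (sign r * p) ≡ fromℕ ((k ∸ j ∸ 1) C (k ∸ r ∸ 1)) * p
signedEntry-oddIndex k j r p j-odd =
  entry*sign k j r ((k ∸ j ∸ 1) C (k ∸ r ∸ 1)) p (entry-byParity k j r false j-odd)

signedEntry-evenIndex : ∀ k j r p → isEven j ≡ true →
  entry k j r * (sign r * p) ≡ fromℕ (if j ℕ.≡ᵇ k ∸ r then 0 else (k ∸ j ∸ 1) C (r ∸ 1)) * p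
signedEntry-evenIndex k j r p j-even = entry*sign k j r m p (trans (entry-byParity k j r true j-even)
  (cong (λ m → sign r * fromℕ m) (ℕ.+-identityʳ m)))
  where
  m : ℕ
  m = if j ℕ.≡ᵇ k ∸ r then 0 else (k ∸ j ∸ 1) C (r ∸ 1)

coefficient-evenRow : ∀ N t u x → isEven t ≡ true → t ≤ N → u ≤ N →
  entry (suc (suc N)) (suc t) (suc u) * (sign (suc u) * x ^ u) ≡ fromℕ ((N ∸ t) C (N ∸ u)) * x ^ u
coefficient-evenRow N t u x t-even t≤N u≤N = begin
  entry (suc (suc N)) (suc t) (suc u) * (sign (suc u) * x ^ u)
    ≡⟨ signedEntry-oddIndex (suc (suc N)) (suc t) (suc u) (x ^ u) (trans (isEven-suc t) (cong not t-even)) ⟩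
  fromℕ ((suc N ∸ t ∸ 1) C (suc N ∸ u ∸ 1)) * x ^ u
    ≡⟨ cong₂ (λ a b → fromℕ (a C b) * x ^ u) ([1+m∸n]∸1≡m∸n t≤N) ([1+m∸n]∸1≡m∸n u≤N) ⟩
  fromℕ ((N ∸ t) C (N ∸ u)) * x ^ u
    ∎
  where open ≡-Reasoning

coefficient-oddRow : ∀ N t u x → isEven t ≡ false → t ≤ N → u ≤ N → u ≢ N ∸ t →
  entry (suc (suc N)) (suc t) (suc u) * (sign (suc u) * x ^ u) ≡ fromℕ ((N ∸ t) C u) * x ^ u
coefficient-oddRow N t u x t-odd t≤N u≤N u≢N∸t = begin
  entry (suc (suc N)) (suc t) (suc u) * (sign (suc u) * x ^ u)
    ≡⟨ signedEntry-evenIndex (suc (suc N)) (suc t) (suc u) (x ^ u) (trans (isEven-suc t) (cong not t-odd)) ⟩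
  fromℕ (if suc t ℕ.≡ᵇ suc N ∸ u then 0 else (suc N ∸ t ∸ 1) C u) * x ^ u
    ≡⟨ cong (λ m → fromℕ (if suc t ℕ.≡ᵇ m then 0 else (suc N ∸ t ∸ 1) C u) * x ^ u) (ℕ.+-∸-assoc 1 u≤N) ⟩
  fromℕ (if t ℕ.≡ᵇ N ∸ u then 0 else (suc N ∸ t ∸ 1) C u) * x ^ u
    ≡⟨ cong (λ b → fromℕ (if b then 0 else (suc N ∸ t ∸ 1) C u) * x ^ u) (≢⇒≡ᵇ≡false t≢N∸u) ⟩
  fromℕ ((suc N ∸ t ∸ 1) C u) * x ^ u
    ≡⟨ cong (λ a → fromℕ (a C u) * x ^ u) ([1+m∸n]∸1≡m∸n t≤N) ⟩
  fromℕ ((N ∸ t) C u) * x ^ u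
    ∎
  where
  open ≡-Reasoning
  t≢N∸u : t ≢ N ∸ u
  t≢N∸u t≡N∸u = u≢N∸t (trans (sym (ℕ.m∸[m∸n]≡n u≤N)) (cong (N ∸_) (sym t≡N∸u)))

coefficient-oddRow-diagonal : ∀ N t x → isEven t ≡ false → t ≤ N →
  entry (suc (suc N)) (suc t) (suc (N ∸ t)) * (sign (suc (N ∸ t)) * x ^ (N ∸ t)) ≡ 0ℚ
coefficient-oddRow-diagonal N t x t-odd t≤N = begin
  entry (suc (suc N)) (suc t) (suc n) * (sign (suc n) * x ^ n)
    ≡⟨ signedEntry-evenIndex (suc (suc N)) (suc t) (suc n) (x ^ n) (trans (isEven-suc t) (cong not t-odd)) ⟩
  fromℕ (if suc t ℕ.≡ᵇ suc N ∸ n then 0 else (suc N ∸ t ∸ 1) C n) * x ^ n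
    ≡⟨ cong (λ m → fromℕ (if suc t ℕ.≡ᵇ m then 0 else (suc N ∸ t ∸ 1) C n) * x ^ n) 1+N∸n≡1+t ⟩
  fromℕ (if t ℕ.≡ᵇ t then 0 else (suc N ∸ t ∸ 1) C n) * x ^ n
    ≡⟨ cong (λ b → fromℕ (if b then 0 else (suc N ∸ t ∸ 1) C n) * x ^ n) (Equivalence.to T-≡ (ℕ.≡⇒≡ᵇ t t refl)) ⟩
  0ℚ * x ^ n
    ≡⟨ ℚ.*-zeroˡ (x ^ n) ⟩
  0ℚ
    ∎
  where
  open ≡-Reasoning
  n : ℕ
  n = N ∸ t
  1+N∸n≡1+t : suc N ∸ n ≡ suc t
  1+N∸n≡1+t = trans (ℕ.+-∸-assoc 1 (ℕ.m∸n≤m N t)) (cong suc (ℕ.m∸[m∸n]≡n t≤N))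

rowPolynomial : ℕ → ℕ → ℚ → ℚ
rowPolynomial N t x = ∑< (suc N) (λ u → entry (suc (suc N)) (suc t) (suc u) * (sign (suc u) * x ^ u))

rowPolynomial-evenRow : ∀ N t x → isEven t ≡ true → t ≤ N → rowPolynomial N t x ≡ x ^ t * (1ℚ + x) ^ (N ∸ t)
rowPolynomial-evenRow N t x t-even t≤N = begin
  ∑< (suc N) f                                              ≡⟨ cong (λ L → ∑< L f) 1+N≡t+[1+n] ⟩
  ∑< (t +ℕ suc n) f                                         ≡⟨ ∑<-+ t (suc n) f ⟩
  ∑< t f + ∑< (suc n) (λ v → f (t +ℕ v))                    ≡⟨ cong₂ _+_ (∑<-zero t below) (∑<-cong (suc n) above) ⟩
  0ℚ + ∑< (suc n) (λ v → x ^ t * (fromℕ (n C v) * x ^ v))   ≡⟨ ℚ.+-identityˡ _ ⟩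
  ∑< (suc n) (λ v → x ^ t * (fromℕ (n C v) * x ^ v))        ≡⟨ *-distribˡ-sum {suc n} (x ^ t) (λ i → fromℕ (n C toℕ i) * x ^ toℕ i) ⟨
  x ^ t * ∑< (suc n) (λ v → fromℕ (n C v) * x ^ v)          ≡⟨ cong (x ^ t *_) (∑<-binomial n x) ⟩
  x ^ t * (1ℚ + x) ^ n                                      ∎
  where
  open ≡-Reasoning
  n : ℕ
  n = N ∸ t
  f : ℕ → ℚ
  f u = entry (suc (suc N)) (suc t) (suc u) * (sign (suc u) * x ^ u)
  1+N≡t+[1+n] : suc N ≡ t +ℕ suc n
  1+N≡t+[1+n] = trans (cong suc (sym (ℕ.m+[n∸m]≡n t≤N))) (sym (ℕ.+-suc t n))
  below : ∀ {u} → u ℕ.< t → f u ≡ 0ℚ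
  below {u} u<t = begin
    f u                                ≡⟨ coefficient-evenRow N t u x t-even t≤N (ℕ.≤-trans (ℕ.<⇒≤ u<t) t≤N) ⟩
    fromℕ (n C (N ∸ u)) * x ^ u        ≡⟨ cong (λ m → fromℕ m * x ^ u) (k>n⇒nCk≡0 (ℕ.∸-monoʳ-< u<t t≤N)) ⟩
    0ℚ * x ^ u                         ≡⟨ ℚ.*-zeroˡ (x ^ u) ⟩
    0ℚ                                 ∎
  above : ∀ {v} → v ℕ.< suc n → f (t +ℕ v) ≡ x ^ t * (fromℕ (n C v) * x ^ v)
  above {v} (s≤s v≤n) = begin
    f (t +ℕ v)                                    ≡⟨ coefficient-evenRow N t (t +ℕ v) x t-even t≤N t+v≤N ⟩
    fromℕ (n C (N ∸ (t +ℕ v))) * x ^ (t +ℕ v)     ≡⟨ cong₂ (λ m p → fromℕ m * p) n-choose (^-homo-* x t v) ⟩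
    fromℕ (n C v) * (x ^ t * x ^ v)               ≡⟨ x∙yz≈y∙xz (fromℕ (n C v)) (x ^ t) (x ^ v) ⟩
    x ^ t * (fromℕ (n C v) * x ^ v)               ∎
    where
    t+v≤N : t +ℕ v ≤ N
    t+v≤N = subst (t +ℕ v ≤_) (ℕ.m+[n∸m]≡n t≤N) (ℕ.+-monoʳ-≤ t v≤n)
    n-choose : n C (N ∸ (t +ℕ v)) ≡ n C v
    n-choose = trans (cong (n C_) (sym (ℕ.∸-+-assoc N t v))) (sym (nCk≡nC[n∸k] v≤n))

rowPolynomial-oddRow : ∀ N t x → isEven t ≡ false → t ≤ N →
                       rowPolynomial N t x ≡ (1ℚ + x) ^ (N ∸ t) - x ^ (N ∸ t)
rowPolynomial-oddRow N t x t-odd t≤N = begin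
  ∑< (suc N) f                                  ≡⟨ cong (λ L → ∑< L f) 1+N≡n+[1+t] ⟩
  ∑< (n +ℕ suc t) f                             ≡⟨ ∑<-+ n (suc t) f ⟩
  ∑< n f + ∑< (suc t) (λ v → f (n +ℕ v))        ≡⟨ cong₂ _+_ (∑<-cong n below) (∑<-zero (suc t) above) ⟩
  ∑< n g + 0ℚ                                   ≡⟨ lemma (∑< n g) (g n) ⟩
  ∑< n g + g n - g n                            ≡⟨ cong₂ _-_ (sym (∑<-suc n g)) gₙ≡xⁿ ⟩
  ∑< (suc n) g - x ^ n                          ≡⟨ cong (_- x ^ n) (∑<-binomial n x) ⟩
  (1ℚ + x) ^ n - x ^ n                          ∎
  where
  open ≡-Reasoning
  n : ℕ
  n = N ∸ t
  f : ℕ → ℚ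
  f u = entry (suc (suc N)) (suc t) (suc u) * (sign (suc u) * x ^ u)
  g : ℕ → ℚ
  g u = fromℕ (n C u) * x ^ u
  1+N≡n+[1+t] : suc N ≡ n +ℕ suc t
  1+N≡n+[1+t] = trans (cong suc (sym (ℕ.m∸n+n≡m t≤N))) (sym (ℕ.+-suc n t))
  n+v≤N : ∀ {v} → v ≤ t → n +ℕ v ≤ N
  n+v≤N v≤t = subst (n +ℕ _ ≤_) (ℕ.m∸n+n≡m t≤N) (ℕ.+-monoʳ-≤ n v≤t)
  gₙ≡xⁿ : g n ≡ x ^ n
  gₙ≡xⁿ = trans (cong (λ m → fromℕ m * x ^ n) (nCn≡1 n)) (ℚ.*-identityˡ (x ^ n))
  below : ∀ {u} → u ℕ.< n → f u ≡ g u
  below {u} u<n = coefficient-oddRow N t u x t-odd t≤N (ℕ.≤-trans (ℕ.<⇒≤ u<n) (ℕ.m∸n≤m N t)) (ℕ.<⇒≢ u<n)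
  above : ∀ {v} → v ℕ.< suc t → f (n +ℕ v) ≡ 0ℚ
  above {zero}  _ = trans (cong f (ℕ.+-identityʳ n)) (coefficient-oddRow-diagonal N t x t-odd t≤N)
  above {suc v} (s≤s v<t) = begin
    f (n +ℕ suc v)                                  ≡⟨ coefficient-oddRow N t (n +ℕ suc v) x t-odd t≤N (n+v≤N v<t) (ℕ.>⇒≢ n<n+1+v) ⟩
    fromℕ (n C (n +ℕ suc v)) * x ^ (n +ℕ suc v)     ≡⟨ cong (λ m → fromℕ m * x ^ (n +ℕ suc v)) (k>n⇒nCk≡0 n<n+1+v) ⟩
    0ℚ * x ^ (n +ℕ suc v)                           ≡⟨ ℚ.*-zeroˡ (x ^ (n +ℕ suc v)) ⟩
    0ℚ                                              ∎
    where
    n<n+1+v : n ℕ.< n +ℕ suc v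
    n<n+1+v = ℕ.m<m+n n (s≤s z≤n)
  lemma : ∀ a b → a + 0ℚ ≡ a + b - b
  lemma = solve-∀ ℚ-ring

-- The rows of M as binary forms

rowForm : ℕ → ℕ → ℚ → ℚ → ℚ
rowForm N t X Y with isEven t
... | true  = X ^ t * Y ^ (N ∸ t)
... | false = (Y - X) ^ t * (Y ^ (N ∸ t) - X ^ (N ∸ t))

^-split : ∀ a {t N} → t ≤ N → a ^ t * a ^ (N ∸ t) ≡ a ^ N
^-split a {t} {N} t≤N = trans (sym (^-homo-* a t (N ∸ t))) (cong (a ^_) (ℕ.m+[n∸m]≡n t≤N))

rowForm-homogeneous : ∀ N t a X Y → t ≤ N → rowForm N t (a * X) (a * Y) ≡ a ^ N * rowForm N t X Y
rowForm-homogeneous N t a X Y t≤N with isEven t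
... | true = begin
  (a * X) ^ t * (a * Y) ^ n           ≡⟨ cong₂ _*_ (^-distrib-* a X t) (^-distrib-* a Y n) ⟩
  a ^ t * X ^ t * (a ^ n * Y ^ n)     ≡⟨ interchange (a ^ t) (X ^ t) (a ^ n) (Y ^ n) ⟩
  a ^ t * a ^ n * (X ^ t * Y ^ n)     ≡⟨ cong (_* (X ^ t * Y ^ n)) (^-split a t≤N) ⟩
  a ^ N * (X ^ t * Y ^ n)             ∎
  where
  open ≡-Reasoning
  n : ℕ
  n = N ∸ t
... | false = begin
  (a * Y - a * X) ^ t * ((a * Y) ^ n - (a * X) ^ n)
    ≡⟨ cong₂ (λ p q → p ^ t * q) (factor a Y X) (cong₂ _-_ (^-distrib-* a Y n) (^-distrib-* a X n)) ⟩
  (a * (Y - X)) ^ t * (a ^ n * Y ^ n - a ^ n * X ^ n)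
    ≡⟨ cong (_* (a ^ n * Y ^ n - a ^ n * X ^ n)) (^-distrib-* a (Y - X) t) ⟩
  a ^ t * (Y - X) ^ t * (a ^ n * Y ^ n - a ^ n * X ^ n)
    ≡⟨ lemma (a ^ t) ((Y - X) ^ t) (a ^ n) (Y ^ n) (X ^ n) ⟩
  a ^ t * a ^ n * ((Y - X) ^ t * (Y ^ n - X ^ n))
    ≡⟨ cong (_* ((Y - X) ^ t * (Y ^ n - X ^ n))) (^-split a t≤N) ⟩
  a ^ N * ((Y - X) ^ t * (Y ^ n - X ^ n))
    ∎
  where
  open ≡-Reasoning
  n : ℕ
  n = N ∸ t
  factor : ∀ a Y X → a * Y - a * X ≡ a * (Y - X)
  factor = solve-∀ ℚ-ring
  lemma : ∀ p q r Y X → p * q * (r * Y - r * X) ≡ p * r * (q * (Y - X))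
  lemma = solve-∀ ℚ-ring

rowForm-symmetric : ∀ N t X Y → isEven t ≡ false → rowForm N t X Y ≡ rowForm N t Y X
rowForm-symmetric N t X Y t-odd rewrite t-odd = begin
  (Y - X) ^ t * (Y ^ n - X ^ n)           ≡⟨ lemma ((Y - X) ^ t) (Y ^ n) (X ^ n) ⟩
  - ((Y - X) ^ t) * (X ^ n - Y ^ n)       ≡⟨ cong (_* (X ^ n - Y ^ n)) (-x^odd (Y - X) {t} t-odd) ⟨
  (- (Y - X)) ^ t * (X ^ n - Y ^ n)       ≡⟨ cong (λ p → p ^ t * (X ^ n - Y ^ n)) (lemma′ X Y) ⟩
  (X - Y) ^ t * (X ^ n - Y ^ n)           ∎
  where
  open ≡-Reasoning
  n : ℕ
  n = N ∸ t
  lemma : ∀ p q r → p * (q - r) ≡ - p * (r - q)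
  lemma = solve-∀ ℚ-ring
  lemma′ : ∀ X Y → - (Y - X) ≡ X - Y
  lemma′ = solve-∀ ℚ-ring

1+x-x^t* : ∀ t x p → (1ℚ + x - x) ^ t * p ≡ p
1+x-x^t* t x p = begin
  (1ℚ + x - x) ^ t * p   ≡⟨ cong (λ y → y ^ t * p) (lemma x) ⟩
  1ℚ ^ t * p             ≡⟨ cong (_* p) (1^n≡1 t) ⟩
  1ℚ * p                 ≡⟨ ℚ.*-identityˡ p ⟩
  p                      ∎
  where
  open ≡-Reasoning
  lemma : ∀ x → 1ℚ + x - x ≡ 1ℚ
  lemma = solve-∀ ℚ-ring

rowForm-line-oddRow : ∀ N t x → isEven t ≡ false → rowForm N t x (1ℚ + x) ≡ (1ℚ + x) ^ (N ∸ t) - x ^ (N ∸ t)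
rowForm-line-oddRow N t x t-odd rewrite t-odd = 1+x-x^t* t x ((1ℚ + x) ^ (N ∸ t) - x ^ (N ∸ t))

rowPolynomial≡rowForm : ∀ N t x → t ≤ N → rowPolynomial N t x ≡ rowForm N t x (1ℚ + x)
rowPolynomial≡rowForm N t x t≤N with isEven t in t-parity
... | true  = rowPolynomial-evenRow N t x t-parity t≤N
... | false = trans (rowPolynomial-oddRow N t x t-parity t≤N) (sym (1+x-x^t* t x ((1ℚ + x) ^ (N ∸ t) - x ^ (N ∸ t))))

evenSkew : (ℚ → ℚ → ℚ) → ℚ → ℚ
evenSkew F y = (F y 1ℚ - F 1ℚ y) + (F (- y) 1ℚ - F 1ℚ (- y))

rowForm-evenSkew-oddRow : ∀ N t y → isEven t ≡ false → evenSkew (rowForm N t) y ≡ 0ℚ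
rowForm-evenSkew-oddRow N t y t-odd = begin
  (F y 1ℚ - F 1ℚ y) + (F (- y) 1ℚ - F 1ℚ (- y))
    ≡⟨ cong₂ (λ p q → (p - F 1ℚ y) + (q - F 1ℚ (- y))) (rowForm-symmetric N t y 1ℚ t-odd) (rowForm-symmetric N t (- y) 1ℚ t-odd) ⟩
  (F 1ℚ y - F 1ℚ y) + (F 1ℚ (- y) - F 1ℚ (- y))
    ≡⟨ lemma (F 1ℚ y) (F 1ℚ (- y)) ⟩
  0ℚ
    ∎
  where
  open ≡-Reasoning
  F : ℚ → ℚ → ℚ
  F = rowForm N t
  lemma : ∀ p q → (p - p) + (q - q) ≡ 0ℚ
  lemma = solve-∀ ℚ-ring

rowForm-evenSkew-evenRow : ∀ N t y → isEven N ≡ false → isEven t ≡ true → t ≤ N →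
                           evenSkew (rowForm N t) y ≡ y ^ t + y ^ t
rowForm-evenSkew-evenRow N t y N-odd t-even t≤N rewrite t-even = begin
  (y ^ t * 1ℚ ^ n - 1ℚ ^ t * y ^ n) + ((- y) ^ t * 1ℚ ^ n - 1ℚ ^ t * (- y) ^ n)
    ≡⟨ cong₂ (λ p q → (y ^ t * p - q * y ^ n) + ((- y) ^ t * p - q * (- y) ^ n)) (1^n≡1 n) (1^n≡1 t) ⟩
  (y ^ t * 1ℚ - 1ℚ * y ^ n) + ((- y) ^ t * 1ℚ - 1ℚ * (- y) ^ n)
    ≡⟨ cong₂ (λ p q → (y ^ t * 1ℚ - 1ℚ * y ^ n) + (p * 1ℚ - 1ℚ * q)) (-x^even y {t} t-even) (-x^odd y {n} (isEven-∸ {N} {t} N-odd t-even t≤N)) ⟩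
  (y ^ t * 1ℚ - 1ℚ * y ^ n) + (y ^ t * 1ℚ - 1ℚ * - (y ^ n))
    ≡⟨ lemma (y ^ t) (y ^ n) ⟩
  y ^ t + y ^ t
    ∎
  where
  open ≡-Reasoning
  n : ℕ
  n = N ∸ t
  lemma : ∀ p q → (p * 1ℚ - 1ℚ * q) + (p * 1ℚ - 1ℚ * - q) ≡ p + p
  lemma = solve-∀ ℚ-ring

-- Linear combinations of the rows

combination : ∀ N → (Fin N → ℚ) → ℚ → ℚ → ℚ
combination N c X Y = sum (λ i → c i * rowForm N (toℕ i) X Y)

combination-line : ∀ N (c : Fin N → ℚ) → (∀ col → Σℚ N (λ i → c i * M (suc (suc N)) i col) ≡ 0ℚ) →
                   ∀ x → combination N c x (1ℚ + x) ≡ 0ℚ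
combination-line N c columns≡0 x = begin
  sum (λ i → c i * rowForm N (toℕ i) x (1ℚ + x))          ≡⟨ sum-cong-≗ {N} (λ i → cong (c i *_) (rowPolynomial≡rowForm N (toℕ i) x (ℕ.<⇒≤ (toℕ<n i)))) ⟨
  sum (λ i → c i * sum (λ u → M′ i u * w u))              ≡⟨ sum-cong-≗ {N} (λ i → *-distribˡ-sum {suc N} (c i) (λ u → M′ i u * w u)) ⟩
  sum (λ i → sum (λ u → c i * (M′ i u * w u)))            ≡⟨ ∑-comm {N} {suc N} (λ i u → c i * (M′ i u * w u)) ⟩
  sum (λ u → sum (λ i → c i * (M′ i u * w u)))            ≡⟨ sum-cong-≗ {suc N} (λ u → sum-cong-≗ {N} (λ i → ℚ.*-assoc (c i) (M′ i u) (w u))) ⟨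
  sum (λ u → sum (λ i → c i * M′ i u * w u))              ≡⟨ sum-cong-≗ {suc N} (λ u → *-distribʳ-sum {N} (w u) (λ i → c i * M′ i u)) ⟨
  sum (λ u → sum (λ i → c i * M′ i u) * w u)              ≡⟨ sum-cong-≗ {suc N} (λ u → cong (_* w u) (trans (sym (Σℚ≡sum N (λ i → c i * M′ i u))) (columns≡0 u))) ⟩
  sum (λ u → 0ℚ * w u)                                    ≡⟨ sum-cong-≗ {suc N} (λ u → ℚ.*-zeroˡ (w u)) ⟩
  sum {suc N} (λ _ → 0ℚ)                                  ≡⟨ sum-replicate-zero (suc N) ⟩
  0ℚ                                                      ∎
  where
  open ≡-Reasoning
  M′ : Fin N → Fin (suc N) → ℚ
  M′ = M (suc (suc N))
  w : Fin (suc N) → ℚ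
  w u = sign (suc (toℕ u)) * x ^ toℕ u

combination-homogeneous : ∀ N c a X Y → combination N c (a * X) (a * Y) ≡ a ^ N * combination N c X Y
combination-homogeneous N c a X Y = begin
  sum (λ i → c i * rowForm N (toℕ i) (a * X) (a * Y))   ≡⟨ sum-cong-≗ {N} (λ i → cong (c i *_) (rowForm-homogeneous N (toℕ i) a X Y (ℕ.<⇒≤ (toℕ<n i)))) ⟩
  sum (λ i → c i * (a ^ N * rowForm N (toℕ i) X Y))     ≡⟨ sum-cong-≗ {N} (λ i → x∙yz≈y∙xz (c i) (a ^ N) (rowForm N (toℕ i) X Y)) ⟩
  sum (λ i → a ^ N * (c i * rowForm N (toℕ i) X Y))     ≡⟨ *-distribˡ-sum {N} (a ^ N) (λ i → c i * rowForm N (toℕ i) X Y) ⟨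
  a ^ N * combination N c X Y                           ∎
  where open ≡-Reasoning

combination-offDiagonal : ∀ N c → (∀ x → combination N c x (1ℚ + x) ≡ 0ℚ) →
                          ∀ {X Y} → X ≢ Y → combination N c X Y ≡ 0ℚ
combination-offDiagonal N c line {X} {Y} X≢Y = begin
  combination N c X Y                      ≡⟨ cong₂ (combination N c) a*x≡X a*[1+x]≡Y ⟨
  combination N c (a * x) (a * (1ℚ + x))   ≡⟨ combination-homogeneous N c a x (1ℚ + x) ⟩
  a ^ N * combination N c x (1ℚ + x)       ≡⟨ cong (a ^ N *_) (line x) ⟩
  a ^ N * 0ℚ                               ≡⟨ ℚ.*-zeroʳ (a ^ N) ⟩
  0ℚ                                       ∎
  where
  open ≡-Reasoning
  a : ℚ
  a = Y - X
  instance
    a-nonZero : ℚ.NonZero a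
    a-nonZero = ℚ.≢-nonZero (λ a≡0 → X≢Y (sym (x∙y⁻¹≈ε⇒x≈y Y X a≡0)))
  x : ℚ
  x = X * 1/ a
  a*x≡X : a * x ≡ X
  a*x≡X = begin
    a * (X * 1/ a)     ≡⟨ x∙yz≈y∙xz a X (1/ a) ⟩
    X * (a * 1/ a)     ≡⟨ cong (X *_) (ℚ.*-inverseʳ a) ⟩
    X * 1ℚ             ≡⟨ ℚ.*-identityʳ X ⟩
    X                  ∎
  a*[1+x]≡Y : a * (1ℚ + x) ≡ Y
  a*[1+x]≡Y = begin
    a * (1ℚ + x)       ≡⟨ ℚ.*-distribˡ-+ a 1ℚ x ⟩
    a * 1ℚ + a * x     ≡⟨ cong (a * 1ℚ +_) a*x≡X ⟩
    a * 1ℚ + X         ≡⟨ lemma Y X ⟩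
    Y                  ∎
    where
    lemma : ∀ Y X → (Y - X) * 1ℚ + X ≡ Y
    lemma = solve-∀ ℚ-ring

evenSkew-sum : ∀ {n} (c : Fin n → ℚ) (F : Fin n → ℚ → ℚ → ℚ) y →
               evenSkew (λ X Y → sum (λ i → c i * F i X Y)) y ≡ sum (λ i → c i * evenSkew (F i) y)
evenSkew-sum {n} c F y = begin
  (S (λ i → F i y 1ℚ) - S (λ i → F i 1ℚ y)) + (S (λ i → F i (- y) 1ℚ) - S (λ i → F i 1ℚ (- y)))
    ≡⟨ cong₂ _+_ (∑-distrib-- (λ i → c i * F i y 1ℚ) (λ i → c i * F i 1ℚ y)) (∑-distrib-- (λ i → c i * F i (- y) 1ℚ) (λ i → c i * F i 1ℚ (- y))) ⟨
  sum (λ i → c i * F i y 1ℚ - c i * F i 1ℚ y) + sum (λ i → c i * F i (- y) 1ℚ - c i * F i 1ℚ (- y))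
    ≡⟨ ∑-distrib-+ (λ i → c i * F i y 1ℚ - c i * F i 1ℚ y) (λ i → c i * F i (- y) 1ℚ - c i * F i 1ℚ (- y)) ⟨
  sum (λ i → (c i * F i y 1ℚ - c i * F i 1ℚ y) + (c i * F i (- y) 1ℚ - c i * F i 1ℚ (- y)))
    ≡⟨ sum-cong-≗ {n} (λ i → lemma (c i) (F i y 1ℚ) (F i 1ℚ y) (F i (- y) 1ℚ) (F i 1ℚ (- y))) ⟩
  sum (λ i → c i * evenSkew (F i) y)
    ∎
  where
  open ≡-Reasoning
  S : (Fin n → ℚ) → ℚ
  S f = sum (λ i → c i * f i)
  lemma : ∀ c p q r s → (c * p - c * q) + (c * r - c * s) ≡ c * ((p - q) + (r - s))
  lemma = solve-∀ ℚ-ring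

evenRows-vanish : ∀ N (c : Fin N → ℚ) → isEven N ≡ false → (∀ x → combination N c x (1ℚ + x) ≡ 0ℚ) →
                  ∀ i → isEven (toℕ i) ≡ true → c i ≡ 0ℚ
evenRows-vanish N c N-odd line i i-even =
  x+x≡0⇒x≡0 (trans (cong (λ p → weight p (c i)) (sym i-even)) (polynomial-vanishing b 2 b-vanishes i))
  where
  weight : Bool → ℚ → ℚ
  weight true  a = a + a
  weight false a = 0ℚ
  b : Fin N → ℚ
  b i = weight (isEven (toℕ i)) (c i)
  term : ∀ y i p → isEven (toℕ i) ≡ p → c i * evenSkew (rowForm N (toℕ i)) y ≡ weight p (c i) * y ^ toℕ i
  term y i true  e = trans (cong (c i *_) (rowForm-evenSkew-evenRow N (toℕ i) y N-odd e (ℕ.<⇒≤ (toℕ<n i)))) (lemma (c i) (y ^ toℕ i))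
    where
    lemma : ∀ c p → c * (p + p) ≡ (c + c) * p
    lemma = solve-∀ ℚ-ring
  term y i false e = trans (cong (c i *_) (rowForm-evenSkew-oddRow N (toℕ i) y e)) (trans (ℚ.*-zeroʳ (c i)) (sym (ℚ.*-zeroˡ (y ^ toℕ i))))
  b-vanishes : ∀ n → 2 ≤ n → polynomial b (fromℕ n) ≡ 0ℚ
  b-vanishes n 2≤n = begin
    polynomial b y                                       ≡⟨ sum-cong-≗ {N} (λ i → term y i (isEven (toℕ i)) refl) ⟨
    sum (λ i → c i * evenSkew (rowForm N (toℕ i)) y)     ≡⟨ evenSkew-sum c (λ i → rowForm N (toℕ i)) y ⟨
    evenSkew (combination N c) y                         ≡⟨ cong₂ _+_ (cong₂ _-_ (vanish y≢1) (vanish (y≢1 ∘ sym)))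
                                                                      (cong₂ _-_ (vanish -y≢1) (vanish (-y≢1 ∘ sym))) ⟩
    (0ℚ - 0ℚ) + (0ℚ - 0ℚ)                                ≡⟨⟩
    0ℚ                                                   ∎
    where
    open ≡-Reasoning
    y : ℚ
    y = fromℕ n
    vanish : ∀ {X Y} → X ≢ Y → combination N c X Y ≡ 0ℚ
    vanish = combination-offDiagonal N c line
    y≢1 : y ≢ 1ℚ
    y≢1 y≡1 = ℕ.<⇒≢ 2≤n (sym (fromℕ-injective {n} {1} y≡1))
    -y≢1 : - y ≢ 1ℚ
    -y≢1 -y≡1 = fromℕ≢-1 n (ℚ.neg-injective {y} { - 1ℚ} -y≡1)

powerSum : ∀ N → (Fin N → ℚ) → ℚ → ℚ
powerSum N c y = sum (λ i → c i * y ^ (N ∸ toℕ i))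

powerSum-zero : ∀ N c → powerSum N c 0ℚ ≡ 0ℚ
powerSum-zero N c = trans (sum-cong-≗ {N} term≡0) (sum-replicate-zero N)
  where
  term≡0 : ∀ i → c i * 0ℚ ^ (N ∸ toℕ i) ≡ 0ℚ
  term≡0 i = begin
    c i * 0ℚ ^ (N ∸ toℕ i)          ≡⟨ cong (λ e → c i * 0ℚ ^ e) (ℕ.+-∸-assoc 1 (toℕ<n i)) ⟩
    c i * 0ℚ ^ suc (N ∸ suc (toℕ i)) ≡⟨ cong (c i *_) (0^[1+n]≡0 (N ∸ suc (toℕ i))) ⟩
    c i * 0ℚ                         ≡⟨ ℚ.*-zeroʳ (c i) ⟩
    0ℚ                               ∎
    where open ≡-Reasoning

powerSum-reversed : ∀ N c y → powerSum N c y ≡ y * polynomial (c ∘ opposite) y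
powerSum-reversed N c y = begin
  powerSum N c y                                             ≡⟨ ∑-permute (λ i → c i * y ^ (N ∸ toℕ i)) Perm.reverse ⟩
  sum (λ i → c (opposite i) * y ^ (N ∸ toℕ (opposite i)))    ≡⟨ sum-cong-≗ {N} reindex ⟩
  sum (λ i → y * (c (opposite i) * y ^ toℕ i))               ≡⟨ *-distribˡ-sum {N} y (λ i → c (opposite i) * y ^ toℕ i) ⟨
  y * polynomial (c ∘ opposite) y                            ∎
  where
  open ≡-Reasoning
  reindex : ∀ i → c (opposite i) * y ^ (N ∸ toℕ (opposite i)) ≡ y * (c (opposite i) * y ^ toℕ i)
  reindex i = begin
    c (opposite i) * y ^ (N ∸ toℕ (opposite i))   ≡⟨ cong (λ e → c (opposite i) * y ^ (N ∸ e)) (opposite-prop i) ⟩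
    c (opposite i) * y ^ (N ∸ (N ∸ suc (toℕ i)))  ≡⟨ cong (λ e → c (opposite i) * y ^ e) (ℕ.m∸[m∸n]≡n (toℕ<n i)) ⟩
    c (opposite i) * (y * y ^ toℕ i)              ≡⟨ x∙yz≈y∙xz (c (opposite i)) y (y ^ toℕ i) ⟩
    y * (c (opposite i) * y ^ toℕ i)              ∎

powerSum-step : ∀ N c → (∀ i → isEven (toℕ i) ≡ true → c i ≡ 0ℚ) →
                ∀ x → powerSum N c (1ℚ + x) ≡ powerSum N c x + combination N c x (1ℚ + x)
powerSum-step N c evenRows≡0 x =
  trans (sum-cong-≗ {N} (λ i → term i (isEven (toℕ i)) refl))
        (∑-distrib-+ (λ i → c i * x ^ (N ∸ toℕ i)) (λ i → c i * rowForm N (toℕ i) x (1ℚ + x)))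
  where
  term : ∀ i p → isEven (toℕ i) ≡ p →
         c i * (1ℚ + x) ^ (N ∸ toℕ i) ≡ c i * x ^ (N ∸ toℕ i) + c i * rowForm N (toℕ i) x (1ℚ + x)
  term i true  e rewrite evenRows≡0 i e =
    lemma ((1ℚ + x) ^ (N ∸ toℕ i)) (x ^ (N ∸ toℕ i)) (rowForm N (toℕ i) x (1ℚ + x))
    where
    lemma : ∀ a b r → 0ℚ * a ≡ 0ℚ * b + 0ℚ * r
    lemma = solve-∀ ℚ-ring
  term i false e = begin
    c i * (1ℚ + x) ^ n                                ≡⟨ lemma (c i) ((1ℚ + x) ^ n) (x ^ n) ⟩
    c i * x ^ n + c i * ((1ℚ + x) ^ n - x ^ n)         ≡⟨ cong (λ r → c i * x ^ n + c i * r) (rowForm-line-oddRow N (toℕ i) x e) ⟨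
    c i * x ^ n + c i * rowForm N (toℕ i) x (1ℚ + x)   ∎
    where
    open ≡-Reasoning
    n : ℕ
    n = N ∸ toℕ i
    lemma : ∀ c a b → c * a ≡ c * b + c * (a - b)
    lemma = solve-∀ ℚ-ring

allRows-vanish : ∀ N (c : Fin N → ℚ) → (∀ x → combination N c x (1ℚ + x) ≡ 0ℚ) →
                 (∀ i → isEven (toℕ i) ≡ true → c i ≡ 0ℚ) → ∀ i → c i ≡ 0ℚ
allRows-vanish N c line evenRows≡0 i =
  subst (λ j → c j ≡ 0ℚ) (opposite-involutive i) (polynomial-vanishing (c ∘ opposite) 1 reversed-vanishes (opposite i))
  where
  open ≡-Reasoning
  powerSum-naturals : ∀ n → powerSum N c (fromℕ n) ≡ 0ℚ
  powerSum-naturals zero    = powerSum-zero N c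
  powerSum-naturals (suc n) = begin
    powerSum N c (fromℕ (suc n))                                  ≡⟨ cong (powerSum N c) (fromℕ-+ 1 n) ⟩
    powerSum N c (1ℚ + fromℕ n)                                   ≡⟨ powerSum-step N c evenRows≡0 (fromℕ n) ⟩
    powerSum N c (fromℕ n) + combination N c (fromℕ n) (1ℚ + fromℕ n) ≡⟨ cong₂ _+_ (powerSum-naturals n) (line (fromℕ n)) ⟩
    0ℚ + 0ℚ                                                       ≡⟨⟩
    0ℚ                                                            ∎
  reversed-vanishes : ∀ n → 1 ≤ n → polynomial (c ∘ opposite) (fromℕ n) ≡ 0ℚ
  reversed-vanishes n 1≤n = x*y≡0⇒y≡0 (λ y≡0 → ℕ.<⇒≢ 1≤n (sym (fromℕ-injective {n} {0} y≡0)))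
                                      (trans (sym (powerSum-reversed N c (fromℕ n))) (powerSum-naturals n))

rows-linearlyIndependent : ∀ N → isEven N ≡ false → LinIndep (M (suc (suc N)))
rows-linearlyIndependent N N-odd c columns≡0 =
  allRows-vanish N c line (evenRows-vanish N c N-odd line)
  where
  line : ∀ x → combination N c x (1ℚ + x) ≡ 0ℚ
  line = combination-line N c columns≡0

proposition4p4 : (k : ℕ) → 3 ≤ k → k % 2 ≡ 1 → IsRank (M k) (k ∸ 2)
proposition4p4 (suc (suc N)) (s≤s (s≤s _)) k-odd =
  -- (2 + N) % 2 reduces to N % 2, so congruence turns k-odd into isEven N ≡ false.
  (id , id , rows-linearlyIndependent N (cong (ℕ._≡ᵇ 0) k-odd)) ,
  λ f f-injective _ → <⇒notInjective (ℕ.n<1+n N) f-injective
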